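{- Let $\mathcal O'$ be an optimal schedule for $A'$ and $\mathcal O''$ an optimal timely schedule for $A'$. Then $\mathcal O''(A')\le(1+\delta)^4\mathcal O'(A')$.
   Context: Let $0<\delta\le1/36$ with $1/\delta$ an integer. Instance $A$: jobs with sizes $a_j>0$, weights $\omega_j>0$, release dates $\rho_j\ge0$; machines with speeds $1=v_1\ge\dots\ge v_m>0$. With $\beta=\delta^2\min_ja_j$, instance $A'$ has the same jobs and machines, with release dates $r'_j=(1+\delta)^{\lceil\log_{1+\delta}(\rho_j+\beta)\rceil}$, speeds $s_i=(1+\delta)^{\lfloor\log_{1+\delta}v_i\rfloor}$, weights $w_j=(1+\delta)^{\lceil\log_{1+\delta}\omega_j\rceil}$, sizes $p_j=(1+\delta)^{\lceil\log_{1+\delta}a_j\rceil}$. A schedule for $A'$ assigns each job $j$ a machine $i$ and a time interval $[C_j-p_j/s_i,C_j)$ starting no earlier than $r'_j$, disjoint on each machine; its cost is $\sum_jw_jC_j$. It is timely if every job $j$ on machine $i$ starts at time at least $\delta p_j/s_i$.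
   Formalization: The sizes, weights, release dates and speeds of A, and the completion times of every schedule for A', including those against which optimality of $\mathcal O'$ and $\mathcal O''$ is measured, are rational. -}

module Defs where

open import Data.Nat as ℕ using (ℕ; zero; suc; NonZero)
import Data.Nat.Properties as ℕP
open import Data.Integer as ℤ using (ℤ; +_; -[1+_])
open import Data.Rational as ℚ using (ℚ; 0ℚ; 1ℚ; _/_; _+_; _*_; _-_; _÷_; _≤_; _<_; _⊓_)
import Data.Rational.Properties as ℚP
open import Data.Fin using (Fin; zero; suc)
import Data.Fin
open import Data.Product using (Σ; _×_; _,_)
open import Data.Sum using (_⊎_)
open import Relation.Binary.PropositionalEquality using (_≡_; _≢_)

δ : (N : ℕ) .{{_ : NonZero N}} → ℚ
δ N = + 1 / N

-- (1+δ)^k for k ∈ ℤ, where 1+δ = (N+1)/N.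
pow : (N : ℕ) .{{_ : NonZero N}} → ℤ → ℚ
pow N (+ k) = (+ (suc N ℕ.^ k)) / (N ℕ.^ k)
  where instance _ = ℕP.m^n≢0 N k
pow N -[1+ k ] = (+ (N ℕ.^ suc k)) / (suc N ℕ.^ suc k)
  where instance _ = ℕP.m^n≢0 (suc N) (suc k)

pow-nonZero : (N : ℕ) .{{_ : NonZero N}} (k : ℤ) → ℚ.NonZero (pow N k)
pow-nonZero N (+ k) = ℚP.pos⇒nonZero (pow N (+ k)) {{ℚP.normalize-pos (suc N ℕ.^ k) (N ℕ.^ k) {{ℕP.m^n≢0 N k}} {{ℕP.m^n≢0 (suc N) k}}}}
pow-nonZero N -[1+ k ] = ℚP.pos⇒nonZero (pow N -[1+ k ]) {{ℚP.normalize-pos (N ℕ.^ suc k) (suc N ℕ.^ suc k) {{ℕP.m^n≢0 (suc N) (suc k)}} {{ℕP.m^n≢0 N (suc k)}}}}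

-- x ↦ (1+δ)^⌈log_{1+δ} x⌉ : k is the exponent iff (1+δ)^(k-1) < x ≤ (1+δ)^k
IsCeilExp : (N : ℕ) .{{_ : NonZero N}} → ℚ → ℤ → Set
IsCeilExp N x k = (pow N (k ℤ.- ℤ.1ℤ) < x) × (x ≤ pow N k)

-- x ↦ (1+δ)^⌊log_{1+δ} x⌋ : k is the exponent iff (1+δ)^k ≤ x < (1+δ)^(k+1)
IsFloorExp : (N : ℕ) .{{_ : NonZero N}} → ℚ → ℤ → Set
IsFloorExp N x k = (pow N k ≤ x) × (x < pow N (k ℤ.+ ℤ.1ℤ))

sumF : ∀ {n} → (Fin n → ℚ) → ℚ
sumF {zero} f = 0ℚ
sumF {suc n} f = f zero + sumF (λ j → f (suc j))

-- minimum of a nonempty family; for n = 0 the value is irrelevant (0).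
minF : ∀ {n} → (Fin n → ℚ) → ℚ
minF {zero} f = 0ℚ
minF {suc zero} f = f zero
minF {suc (suc n)} f = f zero ⊓ minF (λ j → f (suc j))

record InstanceA (n M : ℕ) : Set where
  field
    a ω ρ : Fin n → ℚ         -- sizes, weights, release dates
    v     : Fin M → ℚ         -- speeds
    a-pos : ∀ j → 0ℚ < a j
    ω-pos : ∀ j → 0ℚ < ω j
    ρ-nonneg : ∀ j → 0ℚ ≤ ρ j
    v-pos : ∀ i → 0ℚ < v i
    v-mono : ∀ (i i' : Fin M) → i Data.Fin.≤ i' → v i' ≤ v i

-- The rounded instance A', given through the (uniquely determined)
-- exponents of its data as powers of (1+δ).
record Rounding (N : ℕ) .{{_ : NonZero N}} {n M : ℕ} (A : InstanceA n M) : Set where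
  open InstanceA A
  field
    eR eW eP : Fin n → ℤ
    eS       : Fin M → ℤ
    eR-ok : ∀ j → IsCeilExp N (ρ j + (δ N * δ N) * minF a) (eR j)
    eS-ok : ∀ i → IsFloorExp N (v i) (eS i)
    eW-ok : ∀ j → IsCeilExp N (ω j) (eW j)
    eP-ok : ∀ j → IsCeilExp N (a j) (eP j)

  r' w p : Fin n → ℚ
  r' j = pow N (eR j)
  w  j = pow N (eW j)
  p  j = pow N (eP j)

  s : Fin M → ℚ
  s i = pow N (eS i)

  ptime : Fin n → Fin M → ℚ
  ptime j i = _÷_ (p j) (s i) {{pow-nonZero N (eS i)}}

  record Schedule : Set where
    field
      mach : Fin n → Fin M
      C    : Fin n → ℚ
    start : Fin n → ℚ
    start j = C j - ptime j (mach j)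
    field
      released : ∀ j → r' j ≤ start j
      disjoint : ∀ j k → j ≢ k → mach j ≡ mach k →
                 (C j ≤ start k) ⊎ (C k ≤ start j)

  cost : Schedule → ℚ
  cost S = sumF (λ j → w j * Schedule.C S j)

  Timely : Schedule → Set
  Timely S = ∀ j → δ N * ptime j (Schedule.mach S j) ≤ Schedule.start S j

  Optimal : Schedule → Set
  Optimal O = ∀ S → cost O ≤ cost S

  OptimalTimely : Schedule → Set
  OptimalTimely O = Timely O × (∀ S → Timely S → cost O ≤ cost S)

module Submission where

-- Stretching an optimal schedule makes it timely.
--
-- Let O' be an optimal schedule for A' and put κ = (1+δ)^4.  Multiplying
-- every completion time of O' by κ (same machines) gives a schedule S:
-- a job j of O' with start x ≥ 0 and processing time t = p_j/s_i now starts
-- at  κ(x+t) - t ≥ κx + δt,  using only κ ≥ 1+δ.  Since κx ≥ x ≥ r'_j the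
-- release dates are respected, since κx ≥ 0 the job starts no earlier than
-- δt (S is timely), and since κ is increasing every gap between consecutive
-- jobs of O' is stretched, so S is again disjoint.  Its cost is κ·cost(O'),
-- hence the optimal timely schedule O'' costs at most (1+δ)^4·cost(O').

open import Defs
open import Data.Nat as ℕ using (ℕ; suc; NonZero; _≤_)
import Data.Nat.Properties as ℕP
open import Data.Nat.Tactic.RingSolver using (solve-∀)
open import Data.Fin using (Fin; zero; suc)
open import Data.Integer as ℤ using (ℤ; +_)
import Data.Integer.Properties as ℤP
open import Data.Rational using (1ℚ)
import Data.Rational as Q
open Q using (ℚ; 0ℚ; _+_; _*_; _-_; _/_)
import Data.Rational.Properties as QP
open import Data.Rational.Solver using (module +-*-Solver)
import Data.Rational.Unnormalised as U
import Data.Rational.Unnormalised.Properties as UP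
open import Data.Product using (_,_)
import Data.Sum as Sum
open import Relation.Binary.PropositionalEquality
  using (_≡_; refl; sym; trans; cong; cong₂; subst₂)

fraction-≤ : ∀ a b c d .{{_ : NonZero b}} .{{_ : NonZero d}} →
             a ℕ.* d ≤ c ℕ.* b → + a / b Q.≤ + c / d
fraction-≤ a (suc b) c (suc d) ad≤cb = QP.toℚᵘ-cancel-≤
  (UP.≤-respˡ-≃ (UP.≃-sym (QP.toℚᵘ-fromℚᵘ (U.mkℚᵘ (+ a) b)))
  (UP.≤-respʳ-≃ (UP.≃-sym (QP.toℚᵘ-fromℚᵘ (U.mkℚᵘ (+ c) d)))
  (U.*≤* (subst₂ ℤ._≤_ (ℤP.pos-* a (suc d)) (ℤP.pos-* c (suc b)) (ℤ.+≤+ ad≤cb)))))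

one+δ : (N : ℕ) .{{_ : NonZero N}} → 1ℚ + δ N ≡ + suc N / N
one+δ (suc k) = QP.toℚᵘ-injective (UP.≃-trans (QP.toℚᵘ-homo-+ 1ℚ (δ (suc k)))
  (UP.≃-trans (UP.+-congʳ U.1ℚᵘ (QP.toℚᵘ-fromℚᵘ (U.mkℚᵘ (+ 1) k)))
  (UP.≃-trans (U.*≡* (cong +_ (cross k)))
  (UP.≃-sym (QP.toℚᵘ-fromℚᵘ (U.mkℚᵘ (+ suc (suc k)) k))))))
  where
  -- (1·(k+1) + 1·1)·(k+1) = (k+2)·(1·(k+1)), in the form the definitions unfold to
  cross : ∀ k → suc (k ℕ.+ (k ℕ.+ 0 ℕ.+ 1) ℕ.* suc k) ≡ suc (suc k) ℕ.* suc (k ℕ.+ 0)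
  cross = solve-∀

pow-one : (N : ℕ) .{{_ : NonZero N}} → pow N (+ 1) ≡ + suc N / N
pow-one N = QP./-cong {{ℕP.m^n≢0 N 1}} (cong +_ (ℕP.^-identityʳ (suc N))) (ℕP.^-identityʳ N)

-- (1+δ)^k ≤ (1+δ)^(k+1): after clearing denominators, N·X ≤ (N+1)·X.
pow-step : (N : ℕ) .{{_ : NonZero N}} (k : ℕ) → pow N (+ k) Q.≤ pow N (+ suc k)
pow-step N k = fraction-≤ (suc N ℕ.^ k) (N ℕ.^ k) (suc N ℕ.^ suc k) (N ℕ.^ suc k)
    {{ℕP.m^n≢0 N k}} {{ℕP.m^n≢0 N (suc k)}} (begin
  a ℕ.* (N ℕ.* b)       ≡⟨ swap N a b ⟩
  N ℕ.* (a ℕ.* b)       ≤⟨ ℕP.*-monoˡ-≤ (a ℕ.* b) (ℕP.n≤1+n N) ⟩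
  suc N ℕ.* (a ℕ.* b)   ≡⟨ ℕP.*-assoc (suc N) a b ⟨
  (suc N ℕ.* a) ℕ.* b   ∎)
  where
  open ℕP.≤-Reasoning
  a = suc N ℕ.^ k
  b = N ℕ.^ k
  swap : ∀ n a b → a ℕ.* (n ℕ.* b) ≡ n ℕ.* (a ℕ.* b)
  swap = solve-∀

pow-mono : (N : ℕ) .{{_ : NonZero N}} {k l : ℕ} → k ≤ l → pow N (+ k) Q.≤ pow N (+ l)
pow-mono N k≤l = go (ℕP.≤⇒≤′ k≤l)
  where
  go : ∀ {k l} → k ℕ.≤′ l → pow N (+ k) Q.≤ pow N (+ l)
  go (ℕ.≤′-reflexive refl)        = QP.≤-refl
  go {l = suc l} (ℕ.≤′-step k≤′l) = QP.≤-trans (go k≤′l) (pow-step N l)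

one+δ≤pow4 : (N : ℕ) .{{_ : NonZero N}} → 1ℚ + δ N Q.≤ pow N (+ 4)
one+δ≤pow4 N = begin
  1ℚ + δ N      ≡⟨ one+δ N ⟩
  + suc N / N   ≡⟨ pow-one N ⟨
  pow N (+ 1)   ≤⟨ pow-mono N {1} {4} (ℕ.s≤s ℕ.z≤n) ⟩
  pow N (+ 4)   ∎
  where open QP.≤-Reasoning

pow-pos : (N : ℕ) .{{_ : NonZero N}} (k : ℤ) → Q.Positive (pow N k)
pow-pos N (+ k) =
  QP.normalize-pos (suc N ℕ.^ k) (N ℕ.^ k) {{ℕP.m^n≢0 N k}} {{ℕP.m^n≢0 (suc N) k}}
pow-pos N ℤ.-[1+ k ] =
  QP.normalize-pos (N ℕ.^ suc k) (suc N ℕ.^ suc k) {{ℕP.m^n≢0 (suc N) (suc k)}} {{ℕP.m^n≢0 N (suc k)}}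

δ-nonneg : (N : ℕ) .{{_ : NonZero N}} → 0ℚ Q.≤ δ N
δ-nonneg N = QP.nonNegative⁻¹ (δ N) {{QP.normalize-nonNeg 1 N}}

≤-+-nonNegʳ : ∀ a {b} → 0ℚ Q.≤ b → a Q.≤ a + b
≤-+-nonNegʳ a 0≤b = QP.≤-trans (QP.≤-reflexive (sym (QP.+-identityʳ a))) (QP.+-monoʳ-≤ a 0≤b)

≤-+-nonNegˡ : ∀ a {b} → 0ℚ Q.≤ b → a Q.≤ b + a
≤-+-nonNegˡ a 0≤b = QP.≤-trans (QP.≤-reflexive (sym (QP.+-identityˡ a))) (QP.+-monoˡ-≤ a 0≤b)

*-nonNeg : ∀ {a b} → 0ℚ Q.≤ a → 0ℚ Q.≤ b → 0ℚ Q.≤ a * b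
*-nonNeg {a} {b} 0≤a 0≤b = QP.nonNegative⁻¹ (a * b)
  {{QP.nonNeg*nonNeg⇒nonNeg a {{Q.nonNegative 0≤a}} b {{Q.nonNegative 0≤b}}}}

-- Key inequality of the stretching argument: a job starting at x with
-- length t, stretched by κ ≥ 1+d, now starts at κ(x+t) - t ≥ κx + dt.
stretch-gap : ∀ κ d x t → 1ℚ + d Q.≤ κ → 0ℚ Q.≤ t → κ * x + d * t Q.≤ κ * (x + t) - t
stretch-gap κ d x t κ-big t-nonneg = begin
  κ * x + d * t                 ≡⟨ unfold-d κ x d t ⟩
  κ * x + ((1ℚ + d) * t - t)    ≤⟨ QP.+-monoʳ-≤ (κ * x) (QP.+-monoˡ-≤ (Q.- t)
                                     (QP.*-monoʳ-≤-nonNeg t {{Q.nonNegative t-nonneg}} κ-big)) ⟩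
  κ * x + (κ * t - t)           ≡⟨ refold κ x t ⟩
  κ * (x + t) - t               ∎
  where
  open QP.≤-Reasoning
  open +-*-Solver
  unfold-d : ∀ κ x d t → κ * x + d * t ≡ κ * x + ((1ℚ + d) * t - t)
  unfold-d = solve 4 (λ κ x d t → κ :* x :+ d :* t := κ :* x :+ ((con 1ℚ :+ d) :* t :- t)) refl
  refold : ∀ κ x t → κ * x + (κ * t - t) ≡ κ * (x + t) - t
  refold = solve 3 (λ κ x t → κ :* x :+ (κ :* t :- t) := κ :* (x :+ t) :- t) refl

sumF-cong : ∀ {n} {f g : Fin n → ℚ} → (∀ j → f j ≡ g j) → sumF f ≡ sumF g
sumF-cong {ℕ.zero} f≡g = refl
sumF-cong {suc n}  f≡g = cong₂ _+_ (f≡g zero) (sumF-cong (λ j → f≡g (suc j)))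

sumF-scale : ∀ {n} (q : ℚ) (f : Fin n → ℚ) → sumF (λ j → q * f j) ≡ q * sumF f
sumF-scale {ℕ.zero} q f = sym (QP.*-zeroʳ q)
sumF-scale {suc n}  q f = begin
  q * f zero + sumF (λ j → q * f (suc j))   ≡⟨ cong (_+_ (q * f zero)) (sumF-scale q (λ j → f (suc j))) ⟩
  q * f zero + q * sumF (λ j → f (suc j))   ≡⟨ QP.*-distribˡ-+ q (f zero) (sumF (λ j → f (suc j))) ⟨
  q * sumF f                                ∎
  where open Relation.Binary.PropositionalEquality.≡-Reasoning

module Stretching {N : ℕ} .{{_ : NonZero N}} {n M : ℕ} {A : InstanceA n M}
                  (R : Rounding N A) where
  open Rounding R
  open Schedule

  ptime-nonneg : ∀ j i → 0ℚ Q.≤ ptime j i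
  ptime-nonneg j i = QP.<⇒≤ (QP.positive⁻¹ (ptime j i)
    {{QP.pos*pos⇒pos (p j) {{pow-pos N (eP j)}} _ {{QP.1/pos⇒pos (s i) {{pow-pos N (eS i)}}}}}})

  start-nonneg : (O : Schedule) → ∀ j → 0ℚ Q.≤ start O j
  start-nonneg O j = QP.≤-trans (QP.<⇒≤ (QP.positive⁻¹ (r' j) {{pow-pos N (eR j)}})) (released O j)

  module _ (κ : ℚ) (κ-big : 1ℚ + δ N Q.≤ κ) (O : Schedule) where
    κ-≥1 : 1ℚ Q.≤ κ
    κ-≥1 = QP.≤-trans (≤-+-nonNegʳ 1ℚ (δ-nonneg N)) κ-big

    κ-nonneg : 0ℚ Q.≤ κ
    κ-nonneg = QP.≤-trans (QP.nonNegative⁻¹ 1ℚ) κ-≥1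

    κ-mono : ∀ {x y} → x Q.≤ y → κ * x Q.≤ κ * y
    κ-mono = QP.*-monoˡ-≤-nonNeg κ {{Q.nonNegative κ-nonneg}}

    t x : Fin n → ℚ
    t j = ptime j (mach O j)
    x j = start O j

    stretched-start : ∀ j → κ * x j + δ N * t j Q.≤ κ * C O j - t j
    stretched-start j = QP.≤-trans (stretch-gap κ (δ N) (x j) (t j) κ-big (ptime-nonneg j (mach O j)))
                                   (QP.≤-reflexive (cong (λ c → κ * c - t j) (sym (C≡x+t j))))
      where
      open +-*-Solver
      C≡x+t : ∀ j → C O j ≡ x j + t j
      C≡x+t i = solve 2 (λ c u → c := (c :- u) :+ u) refl (C O i) (t i)

    κx≤stretched : ∀ j → κ * x j Q.≤ κ * C O j - t j
    κx≤stretched j = QP.≤-trans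
      (≤-+-nonNegʳ (κ * x j) (*-nonNeg (δ-nonneg N) (ptime-nonneg j (mach O j))))
      (stretched-start j)

    stretch : Schedule
    stretch = record
      { mach     = mach O
      ; C        = λ j → κ * C O j
      ; released = λ j → QP.≤-trans (released O j) (QP.≤-trans (x≤κx j) (κx≤stretched j))
      ; disjoint = λ j k j≢k same → Sum.map (after k) (after j) (disjoint O j k j≢k same)
      }
      where
      x≤κx : ∀ j → x j Q.≤ κ * x j
      x≤κx j = QP.≤-trans (QP.≤-reflexive (sym (QP.*-identityˡ (x j))))
                          (QP.*-monoʳ-≤-nonNeg (x j) {{Q.nonNegative (start-nonneg O j)}} κ-≥1)
      after : ∀ k {c} → c Q.≤ x k → κ * c Q.≤ κ * C O k - t k
      after k c≤x = QP.≤-trans (κ-mono c≤x) (κx≤stretched k)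

    stretch-timely : Timely stretch
    stretch-timely j = QP.≤-trans
      (≤-+-nonNegˡ (δ N * t j) (*-nonNeg κ-nonneg (start-nonneg O j)))
      (stretched-start j)

    cost-stretch : cost stretch ≡ κ * cost O
    cost-stretch = trans (sumF-cong (λ j → swap (w j) κ (C O j))) (sumF-scale κ (λ j → w j * C O j))
      where
      open +-*-Solver
      swap : ∀ a b c → a * (b * c) ≡ b * (a * c)
      swap = solve 3 (λ a b c → a :* (b :* c) := b :* (a :* c)) refl

mainTheorem14 : (N : ℕ) .{{_ : NonZero N}} → 36 ≤ N →
  (n m : ℕ) (A : InstanceA n (suc m)) → InstanceA.v A zero ≡ 1ℚ →
  (R : Rounding N A) →
  (O' O'' : Rounding.Schedule R) →
  Rounding.Optimal R O' → Rounding.OptimalTimely R O'' →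
  Rounding.cost R O'' Q.≤ pow N (+ 4) Q.* Rounding.cost R O'
mainTheorem14 N _ n m A _ R O' O'' _ (_ , O''-optimal) = begin
  cost O''                   ≤⟨ O''-optimal (stretch κ κ-big O') (stretch-timely κ κ-big O') ⟩
  cost (stretch κ κ-big O')  ≡⟨ cost-stretch κ κ-big O' ⟩
  κ * cost O'                ∎
  where
  open Rounding R
  open Stretching R
  open QP.≤-Reasoning
  κ = pow N (+ 4)
  κ-big : 1ℚ + δ N Q.≤ κ
  κ-big = one+δ≤pow4 N
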